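{- A quasi-topos $\mathcal{C}$ is a topos if and only if its doctrine of strong subobjects $\mathrm{Stg}_{\mathcal{C}}:\mathcal{C}^{op}\to\mathbf{InfSL}$ satisfies the rule of unique choice.
   Context: A quasi-topos is a category with finite limits and finite colimits, locally cartesian closed, with a classifier for strong monomorphisms. $\mathrm{Stg}_{\mathcal{C}}$ sends an object $A$ to the poset of subobjects of $A$ represented by strong monomorphisms, and an arrow $f$ to pullback along $f$; it is an elementary existential doctrine in which $\top_A$ is the identity subobject, the fibred equality $\delta_A$ on $A$ is the diagonal $A\to A\times A$, and the left adjoint $\exists_f$ to pullback along $f$ sends a strong subobject to the strong-monomorphism part of the (epi, strong mono) factorization of its composite with $f$. For a doctrine $P$ of this kind, a relation $F\in P(A\times B)$ is total if $\exists_{pr_1}(F)=\top_A$, and single-valued if $P_{\langle pr_1,pr_2\rangle}(F)\wedge P_{\langle pr_1,pr_3\rangle}(F)\le P_{\langle pr_2,pr_3\rangle}(\delta_B)$ in $P(A\times B\times B)$; $P$ satisfies the rule of unique choice if for every total single-valued $F\in P(A\times B)$ there is $f:A\to B$ with $F=P_{f\times id_B}(\delta_B)$. -}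

module Defs where

open import Level using (Level; _⊔_; suc)
open import Data.Product using (Σ; Σ-syntax; _×_; _,_; proj₁; proj₂)
open import Relation.Binary.Core using (Rel)
open import Relation.Binary.Structures using (IsEquivalence)

record Category (o ℓ e : Level) : Set (suc (o ⊔ ℓ ⊔ e)) where
  infix  4 _≈_
  infixr 9 _∘_
  field
    Obj       : Set o
    _⇒_       : Obj → Obj → Set ℓ
    _≈_       : ∀ {A B} → Rel (A ⇒ B) e
    isEquiv   : ∀ {A B} → IsEquivalence (_≈_ {A} {B})
    id        : ∀ {A} → A ⇒ A
    _∘_       : ∀ {A B C} → B ⇒ C → A ⇒ B → A ⇒ C
    assoc     : ∀ {A B C D} {f : A ⇒ B} {g : B ⇒ C} {h : C ⇒ D} →
                (h ∘ g) ∘ f ≈ h ∘ (g ∘ f)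
    identityˡ : ∀ {A B} {f : A ⇒ B} → id ∘ f ≈ f
    identityʳ : ∀ {A B} {f : A ⇒ B} → f ∘ id ≈ f
    ∘-resp-≈  : ∀ {A B C} {f h : B ⇒ C} {g i : A ⇒ B} →
                f ≈ h → g ≈ i → f ∘ g ≈ h ∘ i

Slice : ∀ {o ℓ e} (C : Category o ℓ e) → Category.Obj C → Category (o ⊔ ℓ) (ℓ ⊔ e) e
Slice C A = record
  { Obj       = Σ Obj (λ X → X ⇒ A)
  ; _⇒_       = λ { (X , p) (Y , q) → Σ (X ⇒ Y) (λ f → q ∘ f ≈ p) }
  ; _≈_       = λ f g → proj₁ f ≈ proj₁ g
  ; isEquiv   = record { refl = E.refl isEquiv ; sym = E.sym isEquiv ; trans = E.trans isEquiv }
  ; id        = id , identityʳ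
  ; _∘_       = λ { {X , p} {Y , q} {Z , r} (g , rg) (f , qf) →
                  (g ∘ f) , E.trans isEquiv (E.sym isEquiv assoc)
                              (E.trans isEquiv (∘-resp-≈ rg (E.refl isEquiv)) qf) }
  ; assoc     = assoc
  ; identityˡ = identityˡ
  ; identityʳ = identityʳ
  ; ∘-resp-≈  = ∘-resp-≈
  }
  where
  open Category C
  module E = IsEquivalence

module _ {o ℓ e} (C : Category o ℓ e) where
  open Category C

  Mono : ∀ {X Y} → X ⇒ Y → Set (o ⊔ ℓ ⊔ e)
  Mono {X} m = ∀ {Z} (g h : Z ⇒ X) → m ∘ g ≈ m ∘ h → g ≈ h

  Epi : ∀ {X Y} → X ⇒ Y → Set (o ⊔ ℓ ⊔ e)
  Epi {Y = Y} f = ∀ {Z} (g h : Y ⇒ Z) → g ∘ f ≈ h ∘ f → g ≈ h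

  -- strong mono: a mono with the unique diagonal fill-in property
  -- against every epimorphism (uniqueness follows from m mono)
  StrongMono : ∀ {X Y} → X ⇒ Y → Set (o ⊔ ℓ ⊔ e)
  StrongMono {X} {Y} m =
    Mono m ×
    (∀ {S T} (ep : S ⇒ T) → Epi ep → (u : S ⇒ X) (v : T ⇒ Y) →
       m ∘ u ≈ v ∘ ep → Σ (T ⇒ X) (λ d → (d ∘ ep ≈ u) × (m ∘ d ≈ v)))

  IsPullbackOf : ∀ {A B X Y} → A ⇒ B → Y ⇒ B → X ⇒ A → Set (o ⊔ ℓ ⊔ e)
  IsPullbackOf {A} {B} {X} {Y} f n m =
    Σ (X ⇒ Y) λ g → (n ∘ g ≈ f ∘ m) ×
      (∀ {Z} (u : Z ⇒ A) (v : Z ⇒ Y) → f ∘ u ≈ n ∘ v →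
         Σ (Z ⇒ X) λ w → (m ∘ w ≈ u) × (g ∘ w ≈ v) ×
           (∀ (w′ : Z ⇒ X) → m ∘ w′ ≈ u → g ∘ w′ ≈ v → w′ ≈ w))

  _≤ₛ_ : ∀ {A X Y} → X ⇒ A → Y ⇒ A → Set (ℓ ⊔ e)
  _≤ₛ_ {X = X} {Y} m n = Σ (X ⇒ Y) λ k → n ∘ k ≈ m

  _≅ₛ_ : ∀ {A X Y} → X ⇒ A → Y ⇒ A → Set (ℓ ⊔ e)
  m ≅ₛ n = (m ≤ₛ n) × (n ≤ₛ m)

  record Terminal : Set (o ⊔ ℓ ⊔ e) where
    field
      ⊤    : Obj
      !    : ∀ {A} → A ⇒ ⊤
      !-unique : ∀ {A} (f : A ⇒ ⊤) → f ≈ !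

  record Initial : Set (o ⊔ ℓ ⊔ e) where
    field
      ⊥    : Obj
      ¡    : ∀ {A} → ⊥ ⇒ A
      ¡-unique : ∀ {A} (f : ⊥ ⇒ A) → f ≈ ¡

  record Product (A B : Obj) : Set (o ⊔ ℓ ⊔ e) where
    field
      A×B   : Obj
      π₁    : A×B ⇒ A
      π₂    : A×B ⇒ B
      ⟨_,_⟩ : ∀ {Z} → Z ⇒ A → Z ⇒ B → Z ⇒ A×B
      project₁ : ∀ {Z} {f : Z ⇒ A} {g : Z ⇒ B} → π₁ ∘ ⟨ f , g ⟩ ≈ f
      project₂ : ∀ {Z} {f : Z ⇒ A} {g : Z ⇒ B} → π₂ ∘ ⟨ f , g ⟩ ≈ g
      unique   : ∀ {Z} {f : Z ⇒ A} {g : Z ⇒ B} {h : Z ⇒ A×B} →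
                 π₁ ∘ h ≈ f → π₂ ∘ h ≈ g → h ≈ ⟨ f , g ⟩

  record Coproduct (A B : Obj) : Set (o ⊔ ℓ ⊔ e) where
    field
      A+B   : Obj
      i₁    : A ⇒ A+B
      i₂    : B ⇒ A+B
      [_,_] : ∀ {Z} → A ⇒ Z → B ⇒ Z → A+B ⇒ Z
      inject₁ : ∀ {Z} {f : A ⇒ Z} {g : B ⇒ Z} → [ f , g ] ∘ i₁ ≈ f
      inject₂ : ∀ {Z} {f : A ⇒ Z} {g : B ⇒ Z} → [ f , g ] ∘ i₂ ≈ g
      unique  : ∀ {Z} {f : A ⇒ Z} {g : B ⇒ Z} {h : A+B ⇒ Z} →
                h ∘ i₁ ≈ f → h ∘ i₂ ≈ g → h ≈ [ f , g ]

  record Equalizer {A B : Obj} (f g : A ⇒ B) : Set (o ⊔ ℓ ⊔ e) where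
    field
      E      : Obj
      arr    : E ⇒ A
      equality : f ∘ arr ≈ g ∘ arr
      factor : ∀ {Z} (h : Z ⇒ A) → f ∘ h ≈ g ∘ h → Z ⇒ E
      factor-comm : ∀ {Z} (h : Z ⇒ A) (eq : f ∘ h ≈ g ∘ h) → arr ∘ factor h eq ≈ h
      unique : ∀ {Z} (h : Z ⇒ A) (eq : f ∘ h ≈ g ∘ h) (k : Z ⇒ E) →
               arr ∘ k ≈ h → k ≈ factor h eq

  record Coequalizer {A B : Obj} (f g : A ⇒ B) : Set (o ⊔ ℓ ⊔ e) where
    field
      Q      : Obj
      arr    : B ⇒ Q
      equality : arr ∘ f ≈ arr ∘ g
      factor : ∀ {Z} (h : B ⇒ Z) → h ∘ f ≈ h ∘ g → Q ⇒ Z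
      factor-comm : ∀ {Z} (h : B ⇒ Z) (eq : h ∘ f ≈ h ∘ g) → factor h eq ∘ arr ≈ h
      unique : ∀ {Z} (h : B ⇒ Z) (eq : h ∘ f ≈ h ∘ g) (k : Q ⇒ Z) →
               k ∘ arr ≈ h → k ≈ factor h eq

  record FiniteLimits : Set (o ⊔ ℓ ⊔ e) where
    field
      terminal  : Terminal
      product   : ∀ A B → Product A B
      equalizer : ∀ {A B} (f g : A ⇒ B) → Equalizer f g

  record FiniteColimits : Set (o ⊔ ℓ ⊔ e) where
    field
      initial     : Initial
      coproduct   : ∀ A B → Coproduct A B
      coequalizer : ∀ {A B} (f g : A ⇒ B) → Coequalizer f g

  record Exponential (prod : ∀ A B → Product A B) (A B : Obj) : Set (o ⊔ ℓ ⊔ e) where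
    open Product using (A×B; π₁; π₂)
    _×′_ : Obj → Obj → Obj
    X ×′ Y = A×B (prod X Y)
    _⁂_ : ∀ {X Y} → X ⇒ Y → A ⇒ A → (X ×′ A) ⇒ (Y ×′ A)
    _⁂_ {X} {Y} h k = Product.⟨_,_⟩ (prod Y A) (h ∘ π₁ (prod X A)) (k ∘ π₂ (prod X A))
    field
      B^A   : Obj
      eval  : (B^A ×′ A) ⇒ B
      λg    : ∀ {X} → (X ×′ A) ⇒ B → X ⇒ B^A
      β     : ∀ {X} {f : (X ×′ A) ⇒ B} → eval ∘ (λg f ⁂ id) ≈ f
      λ-unique : ∀ {X} {f : (X ×′ A) ⇒ B} {g : X ⇒ B^A} →
                 eval ∘ (g ⁂ id) ≈ f → g ≈ λg f

  record CartesianClosed : Set (o ⊔ ℓ ⊔ e) where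
    field
      terminal    : Terminal
      product     : ∀ A B → Product A B
      exponential : ∀ A B → Exponential product A B

  record SubobjectClassifier (T : Terminal) : Set (o ⊔ ℓ ⊔ e) where
    open Terminal T
    field
      Ω    : Obj
      true : ⊤ ⇒ Ω
      χ    : ∀ {X Y} (m : X ⇒ Y) → Mono m → Y ⇒ Ω
      χ-pullback : ∀ {X Y} (m : X ⇒ Y) (mono : Mono m) → IsPullbackOf (χ m mono) true m
      χ-unique   : ∀ {X Y} (m : X ⇒ Y) (mono : Mono m) (φ : Y ⇒ Ω) →
                   IsPullbackOf φ true m → φ ≈ χ m mono

  record StrongSubobjectClassifier (T : Terminal) : Set (o ⊔ ℓ ⊔ e) where
    open Terminal T
    field
      Ω    : Obj
      true : ⊤ ⇒ Ω
      true-strong : StrongMono true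
      χ    : ∀ {X Y} (m : X ⇒ Y) → StrongMono m → Y ⇒ Ω
      χ-pullback : ∀ {X Y} (m : X ⇒ Y) (sm : StrongMono m) → IsPullbackOf (χ m sm) true m
      χ-unique   : ∀ {X Y} (m : X ⇒ Y) (sm : StrongMono m) (φ : Y ⇒ Ω) →
                   IsPullbackOf φ true m → φ ≈ χ m sm

  record Topos : Set (o ⊔ ℓ ⊔ e) where
    field
      finiteLimits : FiniteLimits
    open FiniteLimits finiteLimits
    field
      exponential  : ∀ A B → Exponential product A B
      classifier   : SubobjectClassifier terminal

record QuasiTopos {o ℓ e} (C : Category o ℓ e) : Set (suc (o ⊔ ℓ ⊔ e)) where
  field
    finiteLimits   : FiniteLimits C
    finiteColimits : FiniteColimits C
    locallyCC      : ∀ A → CartesianClosed (Slice C A)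
  open FiniteLimits finiteLimits
  field
    strongClassifier : StrongSubobjectClassifier C terminal

-- Elements of Stg_C(A) are represented by strong monos into A; the
-- doctrine operations are expressed through their defining universal
-- constructions in C:
--   * reindexing P_f(n)    : a pullback of n along f
--   * meet a ∧ b           : b ∘ (pullback of a along b)
--   * ∃_f(m)               : strong-mono part of an (epi, strong mono)
--                            factorization of f ∘ m
--   * ⊤_A                  : id_A,   δ_B : ⟨ id , id ⟩ : B → B × B
--   * order / equality     : factorization through / mutual factorization

module Stg {o ℓ e} {C : Category o ℓ e} (Q : QuasiTopos C) where
  open Category C
  open QuasiTopos Q
  open FiniteLimits finiteLimits

  _×ₒ_ : Obj → Obj → Obj
  A ×ₒ B = Product.A×B (product A B)

  π₁ : ∀ {A B} → (A ×ₒ B) ⇒ A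
  π₁ {A} {B} = Product.π₁ (product A B)

  π₂ : ∀ {A B} → (A ×ₒ B) ⇒ B
  π₂ {A} {B} = Product.π₂ (product A B)

  ⟨_,_⟩ : ∀ {Z A B} → Z ⇒ A → Z ⇒ B → Z ⇒ (A ×ₒ B)
  ⟨_,_⟩ {A = A} {B} = Product.⟨_,_⟩ (product A B)

  δ : ∀ {B} → B ⇒ (B ×ₒ B)
  δ = ⟨ id , id ⟩

  IsMeet : ∀ {T U V W} → U ⇒ T → V ⇒ T → W ⇒ T → Set (o ⊔ ℓ ⊔ e)
  IsMeet {V = V} {W = W} a b c = Σ (W ⇒ V) λ m → IsPullbackOf C b a m × (c ≈ b ∘ m)

  -- F ∈ Stg_C(A × B), represented by F : X ⇒ A × B, is total:
  -- ∃_{pr₁}(F) = ⊤_A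
  Total : ∀ {X A B} → X ⇒ (A ×ₒ B) → Set (o ⊔ ℓ ⊔ e)
  Total {X} {A} {B} F =
    Σ Obj λ I → Σ (X ⇒ I) λ ep → Σ (I ⇒ A) λ s →
      Epi C ep × StrongMono C s × (s ∘ ep ≈ π₁ ∘ F) × _≅ₛ_ C s (id {A})

  -- F is single-valued:
  -- P_{⟨pr₁,pr₂⟩}(F) ∧ P_{⟨pr₁,pr₃⟩}(F) ≤ P_{⟨pr₂,pr₃⟩}(δ_B)  in Stg_C(A×B×B)
  -- where A×B×B := (A×B)×B with pr₁ = π₁∘π₁, pr₂ = π₂∘π₁, pr₃ = π₂.
  SingleValued : ∀ {X A B} → X ⇒ (A ×ₒ B) → Set (o ⊔ ℓ ⊔ e)
  SingleValued {X} {A} {B} F =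
    ∀ {U V W D} (a : U ⇒ T) (b : V ⇒ T) (c : W ⇒ T) (d : D ⇒ T) →
      IsPullbackOf C ⟨ pr₁ , pr₂ ⟩ F a →
      IsPullbackOf C ⟨ pr₁ , pr₃ ⟩ F b →
      IsMeet a b c →
      IsPullbackOf C ⟨ pr₂ , pr₃ ⟩ (δ {B}) d →
      _≤ₛ_ C c d
    where
    T : Obj
    T = (A ×ₒ B) ×ₒ B
    pr₁ : T ⇒ A
    pr₁ = π₁ ∘ π₁
    pr₂ : T ⇒ B
    pr₂ = π₂ ∘ π₁
    pr₃ : T ⇒ B
    pr₃ = π₂

  RuleOfUniqueChoice : Set (o ⊔ ℓ ⊔ e)
  RuleOfUniqueChoice =
    ∀ {X A B} (F : X ⇒ (A ×ₒ B)) → StrongMono C F → Total F → SingleValued F →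
      Σ (A ⇒ B) λ f → Σ Obj λ D → Σ (D ⇒ (A ×ₒ B)) λ d →
        IsPullbackOf C ⟨ f ∘ π₁ , id ∘ π₂ ⟩ (δ {B}) d × _≅ₛ_ C F d

-- Both conditions are equivalent to C being balanced (mono + epi ⇒ iso).
-- A topos is balanced: a mono that is epi has the same characteristic map as the
-- identity. Conversely, in a balanced quasi-topos every mono is strong, so the
-- strong-subobject classifier classifies all subobjects, and exponentials come from
-- the slice over the terminal object.
-- In Stg_C a strong relation F ⊆ A × B is total iff π₁ ∘ F is epi, and single-valued
-- iff π₁ ∘ F is mono. So if C is balanced, π₁ ∘ F is invertible and F is the graph
-- of π₂ ∘ F ∘ (π₁ ∘ F)⁻¹; conversely, unique choice applied to the total
-- single-valued relation ⟨ f , id ⟩ ⊆ B × A of a mono epi f yields an inverse of f.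

module Submission where

open import Level using (_⊔_)
open import Data.Product using (Σ; _×_; _,_; proj₁; proj₂)
open import Function.Bundles using (_⇔_; mk⇔)
open import Relation.Binary.Bundles using (Setoid)
open import Relation.Binary.Structures using (IsEquivalence)
import Relation.Binary.Reasoning.Setoid as SetoidReasoning
open import Defs

module Properties {o ℓ e} (C : Category o ℓ e) where
  open Category C

  hom-setoid : Obj → Obj → Setoid ℓ e
  hom-setoid A B = record { isEquivalence = isEquiv {A} {B} }

  module _ {A B : Obj} where
    open IsEquivalence (isEquiv {A} {B}) public
      using () renaming (refl to ≈-refl; sym to ≈-sym; trans to ≈-trans)
    open SetoidReasoning (hom-setoid A B) public

  infix 4 _≤_
  _≤_ : ∀ {A X Y} → X ⇒ A → Y ⇒ A → Set (ℓ ⊔ e)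
  _≤_ = _≤ₛ_ C

  ∘-resp-≈ˡ : ∀ {A B D} {f h : B ⇒ D} {g : A ⇒ B} → f ≈ h → f ∘ g ≈ h ∘ g
  ∘-resp-≈ˡ p = ∘-resp-≈ p ≈-refl

  ∘-resp-≈ʳ : ∀ {A B D} {f : B ⇒ D} {g i : A ⇒ B} → g ≈ i → f ∘ g ≈ f ∘ i
  ∘-resp-≈ʳ p = ∘-resp-≈ ≈-refl p

  sym-assoc : ∀ {A B D E} {f : A ⇒ B} {g : B ⇒ D} {h : D ⇒ E} → h ∘ (g ∘ f) ≈ (h ∘ g) ∘ f
  sym-assoc = ≈-sym assoc

  pullˡ : ∀ {Z A B D} {a : B ⇒ D} {b : A ⇒ B} {c : A ⇒ D} {f : Z ⇒ A} →
          a ∘ b ≈ c → a ∘ (b ∘ f) ≈ c ∘ f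
  pullˡ p = ≈-trans sym-assoc (∘-resp-≈ˡ p)

  cancelˡ : ∀ {Z A B} {a : B ⇒ A} {b : A ⇒ B} {f : Z ⇒ A} → a ∘ b ≈ id → a ∘ (b ∘ f) ≈ f
  cancelˡ p = ≈-trans (pullˡ p) identityˡ

  mono-resp-≈ : ∀ {X Y} {m n : X ⇒ Y} → m ≈ n → Mono C m → Mono C n
  mono-resp-≈ {m = m} {n} m≈n mono g h eq = mono g h (begin
    m ∘ g ≈⟨ ∘-resp-≈ˡ m≈n ⟩
    n ∘ g ≈⟨ eq ⟩
    n ∘ h ≈⟨ ∘-resp-≈ˡ m≈n ⟨
    m ∘ h ∎)

  epi-resp-≈ : ∀ {X Y} {f g : X ⇒ Y} → f ≈ g → Epi C f → Epi C g
  epi-resp-≈ {f = f} {g} f≈g epi h k eq = epi h k (begin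
    h ∘ f ≈⟨ ∘-resp-≈ʳ f≈g ⟩
    h ∘ g ≈⟨ eq ⟩
    k ∘ g ≈⟨ ∘-resp-≈ʳ f≈g ⟨
    k ∘ f ∎)

  epi-∘ : ∀ {X Y Z} {f : Y ⇒ Z} {g : X ⇒ Y} → Epi C f → Epi C g → Epi C (f ∘ g)
  epi-∘ {f = f} {g} epi-f epi-g h k eq = epi-f h k (epi-g (h ∘ f) (k ∘ f) (begin
    (h ∘ f) ∘ g ≈⟨ assoc ⟩
    h ∘ (f ∘ g) ≈⟨ eq ⟩
    k ∘ (f ∘ g) ≈⟨ assoc ⟨
    (k ∘ f) ∘ g ∎))

  section⇒epi : ∀ {X Y} {f : X ⇒ Y} {s : Y ⇒ X} → f ∘ s ≈ id → Epi C f
  section⇒epi {f = f} {s} fs≈id h k eq = begin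
    h             ≈⟨ identityʳ ⟨
    h ∘ id        ≈⟨ ∘-resp-≈ʳ fs≈id ⟨
    h ∘ (f ∘ s)   ≈⟨ sym-assoc ⟩
    (h ∘ f) ∘ s   ≈⟨ ∘-resp-≈ˡ eq ⟩
    (k ∘ f) ∘ s   ≈⟨ assoc ⟩
    k ∘ (f ∘ s)   ≈⟨ ∘-resp-≈ʳ fs≈id ⟩
    k ∘ id        ≈⟨ identityʳ ⟩
    k             ∎

  retraction⇒mono : ∀ {X Y} {m : X ⇒ Y} {r : Y ⇒ X} → r ∘ m ≈ id → Mono C m
  retraction⇒mono {m = m} {r} rm≈id g h eq = begin
    g             ≈⟨ cancelˡ rm≈id ⟨
    r ∘ (m ∘ g)   ≈⟨ ∘-resp-≈ʳ eq ⟩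
    r ∘ (m ∘ h)   ≈⟨ cancelˡ rm≈id ⟩
    h             ∎

  retraction⇒strongMono : ∀ {X Y} {m : X ⇒ Y} {r : Y ⇒ X} → r ∘ m ≈ id → StrongMono C m
  retraction⇒strongMono {m = m} {r} rm≈id = retraction⇒mono rm≈id , fill
    where
    fill : ∀ {S T} (ep : S ⇒ T) → Epi C ep → (u : S ⇒ _) (v : T ⇒ _) → m ∘ u ≈ v ∘ ep →
           Σ (T ⇒ _) λ d → (d ∘ ep ≈ u) × (m ∘ d ≈ v)
    fill ep epi u v sq = r ∘ v , upper , epi (m ∘ (r ∘ v)) v (begin
      (m ∘ (r ∘ v)) ∘ ep ≈⟨ assoc ⟩
      m ∘ ((r ∘ v) ∘ ep) ≈⟨ ∘-resp-≈ʳ upper ⟩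
      m ∘ u              ≈⟨ sq ⟩
      v ∘ ep             ∎)
      where
      upper : (r ∘ v) ∘ ep ≈ u
      upper = begin
        (r ∘ v) ∘ ep ≈⟨ assoc ⟩
        r ∘ (v ∘ ep) ≈⟨ ∘-resp-≈ʳ sq ⟨
        r ∘ (m ∘ u)  ≈⟨ cancelˡ rm≈id ⟩
        u            ∎

  ≤-refl : ∀ {A X} {m : X ⇒ A} → m ≤ m
  ≤-refl = id , identityʳ

  ≤-trans : ∀ {A X Y Z} {m : X ⇒ A} {n : Y ⇒ A} {p : Z ⇒ A} → m ≤ n → n ≤ p → m ≤ p
  ≤-trans {m = m} {n} {p} (k , nk≈m) (l , pl≈n) = l ∘ k , (begin
    p ∘ (l ∘ k) ≈⟨ pullˡ pl≈n ⟩
    n ∘ k       ≈⟨ nk≈m ⟩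
    m           ∎)

  ≤-pullback-intro : ∀ {A B X Y Z} {f : A ⇒ B} {n : Y ⇒ B} {m : X ⇒ A} {x : Z ⇒ A} →
                     IsPullbackOf C f n m → f ∘ x ≤ n → x ≤ m
  ≤-pullback-intro {x = x} (_ , _ , universal) (k , nk≈fx) =
    let w , mw≈x , _ = universal x k (≈-sym nk≈fx) in w , mw≈x

  ≤-pullback-elim : ∀ {A B X Y Z} {f : A ⇒ B} {n : Y ⇒ B} {m : X ⇒ A} {x : Z ⇒ A} →
                    IsPullbackOf C f n m → x ≤ m → f ∘ x ≤ n
  ≤-pullback-elim {f = f} {n} {m} {x} (g , ng≈fm , _) (k , mk≈x) = g ∘ k , (begin
    n ∘ (g ∘ k) ≈⟨ pullˡ ng≈fm ⟩
    (f ∘ m) ∘ k ≈⟨ assoc ⟩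
    f ∘ (m ∘ k) ≈⟨ ∘-resp-≈ʳ mk≈x ⟩
    f ∘ x       ∎)

  pullback-mono : ∀ {A B X Y} {f : A ⇒ B} {n : Y ⇒ B} {m : X ⇒ A} →
                  Mono C n → IsPullbackOf C f n m → Mono C m
  pullback-mono {f = f} {n} {m} mono-n (g , ng≈fm , universal) a b ma≈mb =
    ≈-trans (unique a ma≈mb ga≈gb) (≈-sym (unique b ≈-refl ≈-refl))
    where
    ga≈gb : g ∘ a ≈ g ∘ b
    ga≈gb = mono-n (g ∘ a) (g ∘ b) (begin
      n ∘ (g ∘ a) ≈⟨ pullˡ ng≈fm ⟩
      (f ∘ m) ∘ a ≈⟨ assoc ⟩
      f ∘ (m ∘ a) ≈⟨ ∘-resp-≈ʳ ma≈mb ⟩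
      f ∘ (m ∘ b) ≈⟨ assoc ⟨
      (f ∘ m) ∘ b ≈⟨ pullˡ ng≈fm ⟨
      n ∘ (g ∘ b) ∎)
    square : f ∘ (m ∘ b) ≈ n ∘ (g ∘ b)
    square = ≈-trans sym-assoc (≈-sym (pullˡ ng≈fm))
    unique = proj₂ (proj₂ (proj₂ (universal (m ∘ b) (g ∘ b) square)))

  Balanced : Set (o ⊔ ℓ ⊔ e)
  Balanced = ∀ {X Y} (m : X ⇒ Y) → Mono C m → Epi C m →
             Σ (Y ⇒ X) λ r → (m ∘ r ≈ id) × (r ∘ m ≈ id)

  classifier⇒balanced : ∀ {T} → SubobjectClassifier C T → Balanced
  classifier⇒balanced {T} Ω-classifier {X} {Y} m mono epi = r , mr≈id , mono (r ∘ m) id (begin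
    m ∘ (r ∘ m) ≈⟨ pullˡ mr≈id ⟩
    id ∘ m      ≈⟨ identityˡ ⟩
    m           ≈⟨ identityʳ ⟨
    m ∘ id      ∎)
    where
    open Terminal T
    open SubobjectClassifier Ω-classifier
    χm-pullback = χ-pullback m mono
    g = proj₁ χm-pullback
    χm≈true : χ m mono ≈ true ∘ !
    χm≈true = epi (χ m mono) (true ∘ !) (begin
      χ m mono ∘ m   ≈⟨ proj₁ (proj₂ χm-pullback) ⟨
      true ∘ g       ≈⟨ ∘-resp-≈ʳ (≈-trans (!-unique g) (≈-sym (!-unique (! ∘ m)))) ⟩
      true ∘ (! ∘ m) ≈⟨ sym-assoc ⟩
      (true ∘ !) ∘ m ∎)
    id-factors = proj₂ (proj₂ χm-pullback) id ! (≈-trans identityʳ χm≈true)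
    r : Y ⇒ X
    r = proj₁ id-factors
    mr≈id : m ∘ r ≈ id
    mr≈id = proj₁ (proj₂ id-factors)

  strongClassifier⇒classifier : ∀ {T} → (∀ {X Y} (m : X ⇒ Y) → Mono C m → StrongMono C m) →
                                StrongSubobjectClassifier C T → SubobjectClassifier C T
  strongClassifier⇒classifier all-strong Ω-classifier = record
    { Ω          = Ω
    ; true       = true
    ; χ          = λ m mono → χ m (all-strong m mono)
    ; χ-pullback = λ m mono → χ-pullback m (all-strong m mono)
    ; χ-unique   = λ m mono → χ-unique m (all-strong m mono)
    }
    where open StrongSubobjectClassifier Ω-classifier

module ProductLemmas {o ℓ e} {C : Category o ℓ e} {A B} (P : Product C A B) where
  open Category C
  open Properties C
  open Product P public

  π-jointly-mono : ∀ {Z} {x y : Z ⇒ A×B} → π₁ ∘ x ≈ π₁ ∘ y → π₂ ∘ x ≈ π₂ ∘ y → x ≈ y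
  π-jointly-mono p q = ≈-trans (unique p q) (≈-sym (unique ≈-refl ≈-refl))

  π₁∘⟨⟩∘ : ∀ {Z W} {f : Z ⇒ A} {g : Z ⇒ B} {h : W ⇒ Z} → π₁ ∘ (⟨ f , g ⟩ ∘ h) ≈ f ∘ h
  π₁∘⟨⟩∘ = pullˡ project₁

  π₂∘⟨⟩∘ : ∀ {Z W} {f : Z ⇒ A} {g : Z ⇒ B} {h : W ⇒ Z} → π₂ ∘ (⟨ f , g ⟩ ∘ h) ≈ g ∘ h
  π₂∘⟨⟩∘ = pullˡ project₂

  ⟨⟩∘-injective : ∀ {Z Z′ W} {f : Z ⇒ A} {g : Z ⇒ B} {f′ : Z′ ⇒ A} {g′ : Z′ ⇒ B}
                  {x : W ⇒ Z} {y : W ⇒ Z′} →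
                  ⟨ f , g ⟩ ∘ x ≈ ⟨ f′ , g′ ⟩ ∘ y → f ∘ x ≈ f′ ∘ y × g ∘ x ≈ g′ ∘ y
  ⟨⟩∘-injective eq =
    ≈-trans (≈-sym π₁∘⟨⟩∘) (≈-trans (∘-resp-≈ʳ eq) π₁∘⟨⟩∘) ,
    ≈-trans (≈-sym π₂∘⟨⟩∘) (≈-trans (∘-resp-≈ʳ eq) π₂∘⟨⟩∘)

module _ {o ℓ e} {C : Category o ℓ e} where
  open Category C
  open Properties C
  open Product using (A×B)

  [_⇒_]_×_ : ∀ {A B A′ B′} (P : Product C A B) (Q : Product C A′ B′) →
             A ⇒ A′ → B ⇒ B′ → A×B P ⇒ A×B Q
  [ P ⇒ Q ] f × g = Product.⟨_,_⟩ Q (f ∘ Product.π₁ P) (g ∘ Product.π₂ P)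

  repack : ∀ {A B} (P P′ : Product C A B) → A×B P ⇒ A×B P′
  repack P P′ = Product.⟨_,_⟩ P′ (Product.π₁ P) (Product.π₂ P)

  repack∘repack : ∀ {A B} (P P′ : Product C A B) → repack P′ P ∘ repack P P′ ≈ id
  repack∘repack P P′ = P.π-jointly-mono
    (≈-trans P.π₁∘⟨⟩∘ (≈-trans P′.project₁ (≈-sym identityʳ)))
    (≈-trans P.π₂∘⟨⟩∘ (≈-trans P′.project₂ (≈-sym identityʳ)))
    where
    module P = ProductLemmas P
    module P′ = ProductLemmas P′

  repack∘× : ∀ {A B A′ B′} (P P′ : Product C A B) (Q Q′ : Product C A′ B′)
             {f : A ⇒ A′} {g : B ⇒ B′} →
             repack Q Q′ ∘ [ P ⇒ Q ] f × g ≈ [ P′ ⇒ Q′ ] f × g ∘ repack P P′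
  repack∘× P P′ Q Q′ {f} {g} = Q′.π-jointly-mono
    (begin
      Q′.π₁ ∘ (repack Q Q′ ∘ [ P ⇒ Q ] f × g)   ≈⟨ Q′.π₁∘⟨⟩∘ ⟩
      Q.π₁ ∘ [ P ⇒ Q ] f × g                    ≈⟨ Q.project₁ ⟩
      f ∘ P.π₁                                  ≈⟨ ∘-resp-≈ʳ P′.project₁ ⟨
      f ∘ (P′.π₁ ∘ repack P P′)                 ≈⟨ sym-assoc ⟩
      (f ∘ P′.π₁) ∘ repack P P′                 ≈⟨ Q′.π₁∘⟨⟩∘ ⟨
      Q′.π₁ ∘ ([ P′ ⇒ Q′ ] f × g ∘ repack P P′) ∎)
    (begin
      Q′.π₂ ∘ (repack Q Q′ ∘ [ P ⇒ Q ] f × g)   ≈⟨ Q′.π₂∘⟨⟩∘ ⟩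
      Q.π₂ ∘ [ P ⇒ Q ] f × g                    ≈⟨ Q.project₂ ⟩
      g ∘ P.π₂                                  ≈⟨ ∘-resp-≈ʳ P′.project₂ ⟨
      g ∘ (P′.π₂ ∘ repack P P′)                 ≈⟨ sym-assoc ⟩
      (g ∘ P′.π₂) ∘ repack P P′                 ≈⟨ Q′.π₂∘⟨⟩∘ ⟨
      Q′.π₂ ∘ ([ P′ ⇒ Q′ ] f × g ∘ repack P P′) ∎)
    where
    module P = ProductLemmas P
    module P′ = ProductLemmas P′
    module Q = ProductLemmas Q
    module Q′ = ProductLemmas Q′

module FiniteLimitLemmas {o ℓ e} {C : Category o ℓ e} (limits : FiniteLimits C) where
  open Category C
  open Properties C
  open FiniteLimits limits

  pullback : ∀ {A B Y} (f : A ⇒ B) (n : Y ⇒ B) → Σ Obj λ P → Σ (P ⇒ A) λ m → IsPullbackOf C f n m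
  pullback {A} {Y = Y} f n = E , A×Y.π₁ ∘ arr , A×Y.π₂ ∘ arr , square , universal
    where
    module A×Y = ProductLemmas (product A Y)
    open Equalizer (equalizer (f ∘ A×Y.π₁) (n ∘ A×Y.π₂))
    square : n ∘ (A×Y.π₂ ∘ arr) ≈ f ∘ (A×Y.π₁ ∘ arr)
    square = ≈-trans sym-assoc (≈-trans (≈-sym equality) assoc)
    universal : ∀ {Z} (u : Z ⇒ A) (v : Z ⇒ Y) → f ∘ u ≈ n ∘ v →
                Σ (Z ⇒ E) λ w → ((A×Y.π₁ ∘ arr) ∘ w ≈ u) × ((A×Y.π₂ ∘ arr) ∘ w ≈ v) ×
                  (∀ w′ → (A×Y.π₁ ∘ arr) ∘ w′ ≈ u → (A×Y.π₂ ∘ arr) ∘ w′ ≈ v → w′ ≈ w)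
    universal u v fu≈nv = factor ⟨u,v⟩ equalized ,
      ≈-trans assoc (≈-trans (∘-resp-≈ʳ (factor-comm ⟨u,v⟩ equalized)) A×Y.project₁) ,
      ≈-trans assoc (≈-trans (∘-resp-≈ʳ (factor-comm ⟨u,v⟩ equalized)) A×Y.project₂) ,
      λ w′ p q → unique ⟨u,v⟩ equalized w′ (A×Y.unique (≈-trans sym-assoc p) (≈-trans sym-assoc q))
      where
      ⟨u,v⟩ = A×Y.⟨ u , v ⟩
      equalized : (f ∘ A×Y.π₁) ∘ ⟨u,v⟩ ≈ (n ∘ A×Y.π₂) ∘ ⟨u,v⟩
      equalized = begin
        (f ∘ A×Y.π₁) ∘ ⟨u,v⟩ ≈⟨ assoc ⟩
        f ∘ (A×Y.π₁ ∘ ⟨u,v⟩) ≈⟨ ∘-resp-≈ʳ A×Y.project₁ ⟩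
        f ∘ u                ≈⟨ fu≈nv ⟩
        n ∘ v                ≈⟨ ∘-resp-≈ʳ A×Y.project₂ ⟨
        n ∘ (A×Y.π₂ ∘ ⟨u,v⟩) ≈⟨ sym-assoc ⟩
        (n ∘ A×Y.π₂) ∘ ⟨u,v⟩ ∎

  -- pulling m back along the lower edge v of a lifting square yields a mono that is epi
  -- (because ep factors through it), hence an isomorphism whose inverse gives the diagonal
  balanced⇒strongMono : Balanced → ∀ {X Y} (m : X ⇒ Y) → Mono C m → StrongMono C m
  balanced⇒strongMono balanced {X} {Y} m mono-m = mono-m , fill
    where
    fill : ∀ {S T} (ep : S ⇒ T) → Epi C ep → (u : S ⇒ X) (v : T ⇒ Y) → m ∘ u ≈ v ∘ ep →
           Σ (T ⇒ X) λ d → (d ∘ ep ≈ u) × (m ∘ d ≈ v)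
    fill ep epi u v mu≈vep = g ∘ r , upper , lower
      where
      P = pullback v m
      m* = proj₁ (proj₂ P)
      is-pullback = proj₂ (proj₂ P)
      g = proj₁ is-pullback
      mg≈vm* = proj₁ (proj₂ is-pullback)
      K = proj₂ (proj₂ is-pullback) ep u (≈-sym mu≈vep)
      k = proj₁ K
      m*k≈ep : m* ∘ k ≈ ep
      m*k≈ep = proj₁ (proj₂ K)
      gk≈u : g ∘ k ≈ u
      gk≈u = proj₁ (proj₂ (proj₂ K))
      epi-m* : Epi C m*
      epi-m* h₁ h₂ eq = epi h₁ h₂ (begin
        h₁ ∘ ep        ≈⟨ ∘-resp-≈ʳ m*k≈ep ⟨
        h₁ ∘ (m* ∘ k)  ≈⟨ pullˡ eq ⟩
        (h₂ ∘ m*) ∘ k  ≈⟨ assoc ⟩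
        h₂ ∘ (m* ∘ k)  ≈⟨ ∘-resp-≈ʳ m*k≈ep ⟩
        h₂ ∘ ep        ∎)
      iso = balanced m* (pullback-mono mono-m is-pullback) epi-m*
      r = proj₁ iso
      upper : (g ∘ r) ∘ ep ≈ u
      upper = begin
        (g ∘ r) ∘ ep        ≈⟨ ∘-resp-≈ʳ m*k≈ep ⟨
        (g ∘ r) ∘ (m* ∘ k)  ≈⟨ assoc ⟩
        g ∘ (r ∘ (m* ∘ k))  ≈⟨ ∘-resp-≈ʳ (cancelˡ (proj₂ (proj₂ iso))) ⟩
        g ∘ k               ≈⟨ gk≈u ⟩
        u                   ∎
      lower : m ∘ (g ∘ r) ≈ v
      lower = begin
        m ∘ (g ∘ r)   ≈⟨ pullˡ mg≈vm* ⟩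
        (v ∘ m*) ∘ r  ≈⟨ assoc ⟩
        v ∘ (m* ∘ r)  ≈⟨ ∘-resp-≈ʳ (proj₁ (proj₂ iso)) ⟩
        v ∘ id        ≈⟨ identityʳ ⟩
        v             ∎

module SliceOverTerminal {o ℓ e} {C : Category o ℓ e} (T : Terminal C) where
  open Category C
  open Properties C
  open Terminal T
  module S = Category (Slice C ⊤)

  !-unique₂ : ∀ {Z} {a b : Z ⇒ ⊤} → a ≈ b
  !-unique₂ {a = a} {b} = ≈-trans (!-unique a) (≈-sym (!-unique b))

  _^ : Obj → S.Obj
  X ^ = X , !

  ↑ : ∀ {X Y} {p : X ⇒ ⊤} {q : Y ⇒ ⊤} → X ⇒ Y → S._⇒_ (X , p) (Y , q)
  ↑ f = f , !-unique₂

  underlyingProduct : ∀ {Y Z} → Product (Slice C ⊤) Y Z → Product C (proj₁ Y) (proj₁ Z)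
  underlyingProduct P = record
    { A×B      = proj₁ A×B
    ; π₁       = proj₁ π₁
    ; π₂       = proj₁ π₂
    ; ⟨_,_⟩    = λ {Z} f g → proj₁ (⟨_,_⟩ {Z ^} (↑ f) (↑ g))
    ; project₁ = project₁
    ; project₂ = project₂
    ; unique   = λ {Z} {f} {g} {h} → unique {Z ^} {↑ f} {↑ g} {↑ h}
    }
    where open Product P

  exponentialFromSlice : (prod : ∀ A B → Product C A B) → CartesianClosed (Slice C ⊤) →
                         ∀ A B → Exponential C prod A B
  exponentialFromSlice prod ccc A B = record
    { B^A      = E
    ; eval     = ev ∘ repack (prod E A) (U B^A)
    ; λg       = λ {Y} h → proj₁ (λg (↑ (h ∘ repack (U (Y ^)) (prod Y A))))
    ; β        = λ {Y} {h} → β′ {Y} {h}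
    ; λ-unique = λ {Y} {h} {g} → λ-unique′ {Y} {h} {g}
    }
    where
    open CartesianClosed ccc using (product; exponential)
    open Exponential (exponential (A ^) (B ^))
    E  = proj₁ B^A
    ev = proj₁ eval

    U : ∀ Y → Product C (proj₁ Y) A
    U Y = underlyingProduct (product Y (A ^))

    underlying-⁂ : ∀ {Y} (g : S._⇒_ (Y ^) B^A) →
                   proj₁ (g ⁂ S.id) ≈ [ U (Y ^) ⇒ U B^A ] proj₁ g × id
    underlying-⁂ g = Product.unique (U B^A) (Product.project₁ (product B^A (A ^)))
                                                 (Product.project₂ (product B^A (A ^)))

    eval-repack : ∀ {Y} (g : S._⇒_ (Y ^) B^A) →
                  (ev ∘ repack (prod E A) (U B^A)) ∘ [ prod Y A ⇒ prod E A ] proj₁ g × id ≈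
                  (ev ∘ proj₁ (g ⁂ S.id)) ∘ repack (prod Y A) (U (Y ^))
    eval-repack {Y} g = begin
      (ev ∘ repack (prod E A) (U B^A)) ∘ [ prod Y A ⇒ prod E A ] proj₁ g × id
        ≈⟨ assoc ⟩
      ev ∘ (repack (prod E A) (U B^A) ∘ [ prod Y A ⇒ prod E A ] proj₁ g × id)
        ≈⟨ ∘-resp-≈ʳ (repack∘× (prod Y A) (U (Y ^)) (prod E A) (U B^A)) ⟩
      ev ∘ ([ U (Y ^) ⇒ U B^A ] proj₁ g × id ∘ repack (prod Y A) (U (Y ^)))
        ≈⟨ ∘-resp-≈ʳ (∘-resp-≈ˡ (underlying-⁂ g)) ⟨
      ev ∘ (proj₁ (g ⁂ S.id) ∘ repack (prod Y A) (U (Y ^)))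
        ≈⟨ sym-assoc ⟩
      (ev ∘ proj₁ (g ⁂ S.id)) ∘ repack (prod Y A) (U (Y ^)) ∎

    β′ : ∀ {Y} {h : Product.A×B (prod Y A) ⇒ B} →
         (ev ∘ repack (prod E A) (U B^A)) ∘
           [ prod Y A ⇒ prod E A ] proj₁ (λg (↑ (h ∘ repack (U (Y ^)) (prod Y A)))) × id ≈ h
    β′ {Y} {h} = begin
      (ev ∘ repack (prod E A) (U B^A)) ∘ [ prod Y A ⇒ prod E A ] proj₁ L × id
        ≈⟨ eval-repack L ⟩
      (ev ∘ proj₁ (L ⁂ S.id)) ∘ repack (prod Y A) (U (Y ^))
        ≈⟨ ∘-resp-≈ˡ β ⟩
      (h ∘ repack (U (Y ^)) (prod Y A)) ∘ repack (prod Y A) (U (Y ^))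
        ≈⟨ assoc ⟩
      h ∘ (repack (U (Y ^)) (prod Y A) ∘ repack (prod Y A) (U (Y ^)))
        ≈⟨ ∘-resp-≈ʳ (repack∘repack (prod Y A) (U (Y ^))) ⟩
      h ∘ id
        ≈⟨ identityʳ ⟩
      h ∎
      where L = λg (↑ (h ∘ repack (U (Y ^)) (prod Y A)))

    λ-unique′ : ∀ {Y} {h : Product.A×B (prod Y A) ⇒ B} {g : Y ⇒ E} →
                (ev ∘ repack (prod E A) (U B^A)) ∘ [ prod Y A ⇒ prod E A ] g × id ≈ h →
                g ≈ proj₁ (λg (↑ (h ∘ repack (U (Y ^)) (prod Y A))))
    λ-unique′ {Y} {h} {g} eval∘g≈h = λ-unique {g = ↑ g} (begin
      ev ∘ proj₁ (↑ g ⁂ S.id)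
        ≈⟨ identityʳ ⟨
      (ev ∘ proj₁ (↑ g ⁂ S.id)) ∘ id
        ≈⟨ ∘-resp-≈ʳ (repack∘repack (U (Y ^)) (prod Y A)) ⟨
      (ev ∘ proj₁ (↑ g ⁂ S.id)) ∘ (repack (prod Y A) (U (Y ^)) ∘ repack (U (Y ^)) (prod Y A))
        ≈⟨ sym-assoc ⟩
      ((ev ∘ proj₁ (↑ g ⁂ S.id)) ∘ repack (prod Y A) (U (Y ^))) ∘ repack (U (Y ^)) (prod Y A)
        ≈⟨ ∘-resp-≈ˡ (eval-repack (↑ g)) ⟨
      ((ev ∘ repack (prod E A) (U B^A)) ∘ [ prod Y A ⇒ prod E A ] g × id) ∘ repack (U (Y ^)) (prod Y A)
        ≈⟨ ∘-resp-≈ˡ eval∘g≈h ⟩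
      h ∘ repack (U (Y ^)) (prod Y A) ∎)

balanced⇒topos : ∀ {o ℓ e} {C : Category o ℓ e} → QuasiTopos C → Properties.Balanced C → Topos C
balanced⇒topos {C = C} Q balanced = record
  { finiteLimits = finiteLimits
  ; exponential  = exponentialFromSlice product (locallyCC ⊤)
  ; classifier   = strongClassifier⇒classifier (balanced⇒strongMono balanced) strongClassifier
  }
  where
  open QuasiTopos Q
  open FiniteLimits finiteLimits using (terminal; product)
  open Terminal terminal using (⊤)
  open Properties C using (strongClassifier⇒classifier)
  open FiniteLimitLemmas finiteLimits using (balanced⇒strongMono)
  open SliceOverTerminal terminal using (exponentialFromSlice)

module UniqueChoice {o ℓ e} {C : Category o ℓ e} (Q : QuasiTopos C) where
  open Category C
  open Properties C
  open QuasiTopos Q using (finiteLimits)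
  open FiniteLimits finiteLimits using (product)
  open FiniteLimitLemmas finiteLimits using (pullback)
  open Stg Q
  module × {A B} = ProductLemmas (product A B)

  ≤-meet-intro : ∀ {T U V W Z} {a : U ⇒ T} {b : V ⇒ T} {c : W ⇒ T} {x : Z ⇒ T} →
                 IsMeet a b c → x ≤ a → x ≤ b → x ≤ c
  ≤-meet-intro {b = b} {c} {x} (m , (_ , _ , universal) , c≈bm) (u , au≈x) (v , bv≈x) =
    w , (begin
      c ∘ w       ≈⟨ ∘-resp-≈ˡ c≈bm ⟩
      (b ∘ m) ∘ w ≈⟨ assoc ⟩
      b ∘ (m ∘ w) ≈⟨ ∘-resp-≈ʳ mw≈v ⟩
      b ∘ v       ≈⟨ bv≈x ⟩
      x           ∎)
    where
    W = universal v u (≈-trans bv≈x (≈-sym au≈x))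
    w = proj₁ W
    mw≈v = proj₁ (proj₂ W)

  ≤-meet-elimˡ : ∀ {T U V W} {a : U ⇒ T} {b : V ⇒ T} {c : W ⇒ T} → IsMeet a b c → c ≤ a
  ≤-meet-elimˡ (m , (g , ag≈bm , _) , c≈bm) = g , ≈-trans ag≈bm (≈-sym c≈bm)

  ≤-meet-elimʳ : ∀ {T U V W} {a : U ⇒ T} {b : V ⇒ T} {c : W ⇒ T} → IsMeet a b c → c ≤ b
  ≤-meet-elimʳ (m , _ , c≈bm) = m , ≈-sym c≈bm

  ≤-δ-intro : ∀ {T B D Z} {u v : T ⇒ B} {d : D ⇒ T} {x : Z ⇒ T} →
              IsPullbackOf C ⟨ u , v ⟩ δ d → u ∘ x ≈ v ∘ x → x ≤ d
  ≤-δ-intro {u = u} {v} {x = x} d-pullback ux≈vx = ≤-pullback-intro d-pullback (u ∘ x , ×.π-jointly-mono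
    (begin
      π₁ ∘ (δ ∘ (u ∘ x))     ≈⟨ ×.π₁∘⟨⟩∘ ⟩
      id ∘ (u ∘ x)           ≈⟨ identityˡ ⟩
      u ∘ x                  ≈⟨ ×.π₁∘⟨⟩∘ ⟨
      π₁ ∘ (⟨ u , v ⟩ ∘ x)   ∎)
    (begin
      π₂ ∘ (δ ∘ (u ∘ x))     ≈⟨ ×.π₂∘⟨⟩∘ ⟩
      id ∘ (u ∘ x)           ≈⟨ identityˡ ⟩
      u ∘ x                  ≈⟨ ux≈vx ⟩
      v ∘ x                  ≈⟨ ×.π₂∘⟨⟩∘ ⟨
      π₂ ∘ (⟨ u , v ⟩ ∘ x)   ∎))

  ≤-δ-elim : ∀ {T B D Z} {u v : T ⇒ B} {d : D ⇒ T} {x : Z ⇒ T} →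
             IsPullbackOf C ⟨ u , v ⟩ δ d → x ≤ d → u ∘ x ≈ v ∘ x
  ≤-δ-elim d-pullback x≤d =
    let k≈ux , k≈vx = ×.⟨⟩∘-injective (proj₂ (≤-pullback-elim d-pullback x≤d))
    in ≈-trans (≈-sym k≈ux) k≈vx

  module _ {X A B} (F : X ⇒ (A ×ₒ B)) where

    total⇒π₁-epi : Total F → Epi C (π₁ ∘ F)
    total⇒π₁-epi (_ , _ , _ , epi , _ , s∘ep≈π₁F , _ , (k , sk≈id)) =
      epi-resp-≈ s∘ep≈π₁F (epi-∘ (section⇒epi sk≈id) epi)

    π₁-epi⇒total : Epi C (π₁ ∘ F) → Total F
    π₁-epi⇒total epi = A , π₁ ∘ F , id , epi , retraction⇒strongMono identityˡ , identityˡ , ≤-refl , ≤-refl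

    private
      pr₁ : ((A ×ₒ B) ×ₒ B) ⇒ A
      pr₁ = π₁ ∘ π₁
      pr₂ pr₃ : ((A ×ₒ B) ×ₒ B) ⇒ B
      pr₂ = π₂ ∘ π₁
      pr₃ = π₂

    singleValued⇒π₂-agree : SingleValued F → ∀ {Z} (g h : Z ⇒ X) →
                            π₁ ∘ (F ∘ g) ≈ π₁ ∘ (F ∘ h) → π₂ ∘ (F ∘ g) ≈ π₂ ∘ (F ∘ h)
    singleValued⇒π₂-agree single-valued g h π₁Fg≈π₁Fh = begin
      π₂ ∘ (F ∘ g)   ≈⟨ ∘-resp-≈ʳ ×.project₁ ⟨
      π₂ ∘ (π₁ ∘ t)  ≈⟨ sym-assoc ⟩
      pr₂ ∘ t        ≈⟨ ≤-δ-elim d-pullback t≤d ⟩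
      pr₃ ∘ t        ≈⟨ ×.project₂ ⟩
      π₂ ∘ (F ∘ h)   ∎
      where
      t = ⟨ F ∘ g , π₂ ∘ (F ∘ h) ⟩
      pr₁t≈π₁Fg : pr₁ ∘ t ≈ π₁ ∘ (F ∘ g)
      pr₁t≈π₁Fg = ≈-trans assoc (∘-resp-≈ʳ ×.project₁)
      t₁₂ : ⟨ pr₁ , pr₂ ⟩ ∘ t ≈ F ∘ g
      t₁₂ = ×.π-jointly-mono (≈-trans ×.π₁∘⟨⟩∘ pr₁t≈π₁Fg)
                             (≈-trans ×.π₂∘⟨⟩∘ (≈-trans assoc (∘-resp-≈ʳ ×.project₁)))
      t₁₃ : ⟨ pr₁ , pr₃ ⟩ ∘ t ≈ F ∘ h
      t₁₃ = ×.π-jointly-mono (≈-trans ×.π₁∘⟨⟩∘ (≈-trans pr₁t≈π₁Fg π₁Fg≈π₁Fh))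
                             (≈-trans ×.π₂∘⟨⟩∘ ×.project₂)
      a-pullback = proj₂ (proj₂ (pullback ⟨ pr₁ , pr₂ ⟩ F))
      b-pullback = proj₂ (proj₂ (pullback ⟨ pr₁ , pr₃ ⟩ F))
      a = proj₁ (proj₂ (pullback ⟨ pr₁ , pr₂ ⟩ F))
      b = proj₁ (proj₂ (pullback ⟨ pr₁ , pr₃ ⟩ F))
      m = proj₁ (proj₂ (pullback b a))
      meet : IsMeet a b (b ∘ m)
      meet = m , proj₂ (proj₂ (pullback b a)) , ≈-refl
      d = proj₁ (proj₂ (pullback ⟨ pr₂ , pr₃ ⟩ δ))
      d-pullback = proj₂ (proj₂ (pullback ⟨ pr₂ , pr₃ ⟩ δ))
      t≤meet : t ≤ b ∘ m
      t≤meet = ≤-meet-intro meet (≤-pullback-intro a-pullback (g , ≈-sym t₁₂))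
                                 (≤-pullback-intro b-pullback (h , ≈-sym t₁₃))
      t≤d : t ≤ d
      t≤d = ≤-trans t≤meet (single-valued a b (b ∘ m) d a-pullback b-pullback meet d-pullback)

    singleValued⇒π₁-mono : Mono C F → SingleValued F → Mono C (π₁ ∘ F)
    singleValued⇒π₁-mono mono-F single-valued g h π₁Fg≈π₁Fh = mono-F g h (×.π-jointly-mono
      (≈-trans sym-assoc (≈-trans π₁Fg≈π₁Fh assoc))
      (singleValued⇒π₂-agree single-valued g h (≈-trans sym-assoc (≈-trans π₁Fg≈π₁Fh assoc))))

    π₁-mono⇒singleValued : Mono C (π₁ ∘ F) → SingleValued F
    π₁-mono⇒singleValued mono-π₁F a b c _ a-pullback b-pullback meet d-pullback =
      ≤-δ-intro d-pullback (begin
        pr₂ ∘ c                  ≈⟨ ×.π₂∘⟨⟩∘ ⟨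
        π₂ ∘ (⟨ pr₁ , pr₂ ⟩ ∘ c) ≈⟨ ∘-resp-≈ʳ Fk₁≈ ⟨
        π₂ ∘ (F ∘ k₁)            ≈⟨ ∘-resp-≈ʳ (∘-resp-≈ʳ k₁≈k₂) ⟩
        π₂ ∘ (F ∘ k₂)            ≈⟨ ∘-resp-≈ʳ Fk₂≈ ⟩
        π₂ ∘ (⟨ pr₁ , pr₃ ⟩ ∘ c) ≈⟨ ×.π₂∘⟨⟩∘ ⟩
        pr₃ ∘ c                  ∎)
      where
      c≤a-on-F = ≤-pullback-elim a-pullback (≤-meet-elimˡ meet)
      c≤b-on-F = ≤-pullback-elim b-pullback (≤-meet-elimʳ meet)
      k₁ = proj₁ c≤a-on-F
      k₂ = proj₁ c≤b-on-F
      Fk₁≈ : F ∘ k₁ ≈ ⟨ pr₁ , pr₂ ⟩ ∘ c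
      Fk₁≈ = proj₂ c≤a-on-F
      Fk₂≈ : F ∘ k₂ ≈ ⟨ pr₁ , pr₃ ⟩ ∘ c
      Fk₂≈ = proj₂ c≤b-on-F
      k₁≈k₂ : k₁ ≈ k₂
      k₁≈k₂ = mono-π₁F k₁ k₂ (begin
        (π₁ ∘ F) ∘ k₁            ≈⟨ assoc ⟩
        π₁ ∘ (F ∘ k₁)            ≈⟨ ∘-resp-≈ʳ Fk₁≈ ⟩
        π₁ ∘ (⟨ pr₁ , pr₂ ⟩ ∘ c) ≈⟨ ×.π₁∘⟨⟩∘ ⟩
        pr₁ ∘ c                  ≈⟨ ×.π₁∘⟨⟩∘ ⟨
        π₁ ∘ (⟨ pr₁ , pr₃ ⟩ ∘ c) ≈⟨ ∘-resp-≈ʳ Fk₂≈ ⟨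
        π₁ ∘ (F ∘ k₂)            ≈⟨ assoc ⟨
        (π₁ ∘ F) ∘ k₂            ∎)

    iso-graph-pullback : (r : A ⇒ X) → (π₁ ∘ F) ∘ r ≈ id → r ∘ (π₁ ∘ F) ≈ id →
                         IsPullbackOf C ⟨ ((π₂ ∘ F) ∘ r) ∘ π₁ , id ∘ π₂ ⟩ δ F
    iso-graph-pullback r π₁Fr≈id rπ₁F≈id = π₂ ∘ F , square , universal
      where
      f = (π₂ ∘ F) ∘ r
      fπ₁F≈π₂F : f ∘ (π₁ ∘ F) ≈ π₂ ∘ F
      fπ₁F≈π₂F = ≈-trans assoc (≈-trans (∘-resp-≈ʳ rπ₁F≈id) identityʳ)
      square : δ ∘ (π₂ ∘ F) ≈ ⟨ f ∘ π₁ , id ∘ π₂ ⟩ ∘ F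
      square = ×.π-jointly-mono
        (begin
          π₁ ∘ (δ ∘ (π₂ ∘ F))               ≈⟨ ×.π₁∘⟨⟩∘ ⟩
          id ∘ (π₂ ∘ F)                     ≈⟨ identityˡ ⟩
          π₂ ∘ F                            ≈⟨ fπ₁F≈π₂F ⟨
          f ∘ (π₁ ∘ F)                      ≈⟨ sym-assoc ⟩
          (f ∘ π₁) ∘ F                      ≈⟨ ×.π₁∘⟨⟩∘ ⟨
          π₁ ∘ (⟨ f ∘ π₁ , id ∘ π₂ ⟩ ∘ F)   ∎)
        (≈-trans ×.π₂∘⟨⟩∘ (≈-trans sym-assoc (≈-sym ×.π₂∘⟨⟩∘)))
      universal : ∀ {Z} (u : Z ⇒ (A ×ₒ B)) (v : Z ⇒ B) → ⟨ f ∘ π₁ , id ∘ π₂ ⟩ ∘ u ≈ δ ∘ v →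
                  Σ (Z ⇒ X) λ w → (F ∘ w ≈ u) × ((π₂ ∘ F) ∘ w ≈ v) ×
                    (∀ w′ → F ∘ w′ ≈ u → (π₂ ∘ F) ∘ w′ ≈ v → w′ ≈ w)
      universal u v u-on-graph = w , Fw≈u , ≈-trans assoc (≈-trans (∘-resp-≈ʳ Fw≈u) π₂u≈v) , unique
        where
        fπ₁u≈v : f ∘ (π₁ ∘ u) ≈ v
        fπ₁u≈v = ≈-trans sym-assoc (≈-trans (proj₁ (×.⟨⟩∘-injective u-on-graph)) identityˡ)
        π₂u≈v : π₂ ∘ u ≈ v
        π₂u≈v = ≈-trans (≈-sym (∘-resp-≈ˡ identityˡ))
                        (≈-trans (proj₂ (×.⟨⟩∘-injective u-on-graph)) identityˡ)
        w = r ∘ (π₁ ∘ u)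
        Fw≈u : F ∘ w ≈ u
        Fw≈u = ×.π-jointly-mono
          (begin
            π₁ ∘ (F ∘ (r ∘ (π₁ ∘ u)))  ≈⟨ sym-assoc ⟩
            (π₁ ∘ F) ∘ (r ∘ (π₁ ∘ u))  ≈⟨ cancelˡ π₁Fr≈id ⟩
            π₁ ∘ u                     ∎)
          (begin
            π₂ ∘ (F ∘ (r ∘ (π₁ ∘ u)))  ≈⟨ sym-assoc ⟩
            (π₂ ∘ F) ∘ (r ∘ (π₁ ∘ u))  ≈⟨ sym-assoc ⟩
            f ∘ (π₁ ∘ u)               ≈⟨ fπ₁u≈v ⟩
            v                          ≈⟨ π₂u≈v ⟨
            π₂ ∘ u                     ∎)
        unique : ∀ w′ → F ∘ w′ ≈ u → (π₂ ∘ F) ∘ w′ ≈ v → w′ ≈ w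
        unique w′ Fw′≈u _ = begin
          w′                     ≈⟨ cancelˡ rπ₁F≈id ⟨
          r ∘ ((π₁ ∘ F) ∘ w′)    ≈⟨ ∘-resp-≈ʳ (≈-trans assoc (∘-resp-≈ʳ Fw′≈u)) ⟩
          r ∘ (π₁ ∘ u)           ∎

  balanced⇒uniqueChoice : Balanced → RuleOfUniqueChoice
  balanced⇒uniqueChoice balanced F strong-F total single-valued =
    (π₂ ∘ F) ∘ r , _ , F , iso-graph-pullback F r π₁Fr≈id rπ₁F≈id , ≤-refl , ≤-refl
    where
    iso = balanced (π₁ ∘ F) (singleValued⇒π₁-mono F (proj₁ strong-F) single-valued)
                            (total⇒π₁-epi F total)
    r = proj₁ iso
    π₁Fr≈id = proj₁ (proj₂ iso)
    rπ₁F≈id = proj₂ (proj₂ iso)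

  uniqueChoice⇒balanced : RuleOfUniqueChoice → Balanced
  uniqueChoice⇒balanced choice {A} {B} f mono-f epi-f = g , epi-f (f ∘ g) id fgf≈f , gf≈id
    where
    F : A ⇒ (B ×ₒ A)
    F = ⟨ f , id ⟩
    graph = choice F (retraction⇒strongMono ×.project₂)
                     (π₁-epi⇒total F (epi-resp-≈ (≈-sym ×.project₁) epi-f))
                     (π₁-mono⇒singleValued F (mono-resp-≈ (≈-sym ×.project₁) mono-f))
    g = proj₁ graph
    g-graph = proj₁ (proj₂ (proj₂ (proj₂ graph)))
    F≤g-graph = proj₁ (proj₂ (proj₂ (proj₂ (proj₂ graph))))
    gf≈id : g ∘ f ≈ id
    gf≈id = begin
      g ∘ f          ≈⟨ ∘-resp-≈ʳ ×.project₁ ⟨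
      g ∘ (π₁ ∘ F)   ≈⟨ sym-assoc ⟩
      (g ∘ π₁) ∘ F   ≈⟨ ≤-δ-elim g-graph F≤g-graph ⟩
      (id ∘ π₂) ∘ F  ≈⟨ ∘-resp-≈ˡ identityˡ ⟩
      π₂ ∘ F         ≈⟨ ×.project₂ ⟩
      id             ∎
    fgf≈f : (f ∘ g) ∘ f ≈ id ∘ f
    fgf≈f = ≈-trans assoc (≈-trans (∘-resp-≈ʳ gf≈id) (≈-trans identityʳ (≈-sym identityˡ)))

proposition8p7 : ∀ {o ℓ e} (C : Category o ℓ e) (Q : QuasiTopos C) →
                   Topos C ⇔ Stg.RuleOfUniqueChoice Q
proposition8p7 C Q = mk⇔ topos⇒uniqueChoice uniqueChoice⇒topos
  where
  open Properties C using (classifier⇒balanced)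
  open UniqueChoice Q using (balanced⇒uniqueChoice; uniqueChoice⇒balanced)

  topos⇒uniqueChoice : Topos C → Stg.RuleOfUniqueChoice Q
  topos⇒uniqueChoice topos = balanced⇒uniqueChoice (classifier⇒balanced (Topos.classifier topos))

  uniqueChoice⇒topos : Stg.RuleOfUniqueChoice Q → Topos C
  uniqueChoice⇒topos choice = balanced⇒topos Q (uniqueChoice⇒balanced choice)
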